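{- Let $G=(V,E)$ be a finite simple undirected graph with a total order $\prec$ on $V$ as defined below. Then for every 4-element set $S\subseteq V$: if $G[S]$ is a 4-cycle or a chordal-4-cycle, then exactly one 3-path whose edges lie in $G[S]$ is centered; if $G[S]$ is a 4-clique, then exactly three 3-paths whose edges lie in $G[S]$ are centered.
   Context: Each vertex has a degree $d_v$ and a distinct integer id. Define $u\prec v$ iff $d_u<d_v$, or $d_u=d_v$ and the id of $u$ is less than that of $v$. A 3-path is a set of three edges $\{(t,u),(u,v),(v,w)\}$ with $t,u,v,w$ distinct vertices. Such a 3-path is centered if $v\prec t$, $u\prec w$, and $(t,w)\in E$ (so $t,u,v,w$ form a 4-cycle). (The condition is symmetric under reversing the path.) A chordal-4-cycle is $K_4$ minus one edge; $G[S]$ denotes the induced subgraph on $S$. -}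

module Defs where

open import Data.Nat using (ℕ; zero; suc; _+_)
import Data.Nat as ℕ
open import Data.Integer using (ℤ)
import Data.Integer as ℤ
open import Data.Bool using (Bool; true; false; if_then_else_)
open import Data.Fin using (Fin; zero; suc)
open import Data.Product using (Σ; _×_; _,_; ∃)
open import Data.Sum using (_⊎_)
open import Relation.Binary.PropositionalEquality using (_≡_)
open import Relation.Nullary using (¬_)
open import Function.Definitions using (Injective)

record Graph (n : ℕ) : Set where
  field
    adj   : Fin n → Fin n → Bool
    sym   : ∀ i j → adj i j ≡ adj j i
    irrefl : ∀ i → adj i i ≡ false
    id    : Fin n → ℤ
    id-inj : Injective _≡_ _≡_ id

module _ {n : ℕ} (G : Graph n) where
  open Graph G

  Edge : Fin n → Fin n → Set
  Edge i j = adj i j ≡ true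

  private
    countAdj : ∀ {m} → (Fin m → Fin n) → Fin n → ℕ
    countAdj {zero}  f i = 0
    countAdj {suc m} f i =
      (if adj i (f zero) then 1 else 0) + countAdj (λ k → f (suc k)) i

  deg : Fin n → ℕ
  deg v = countAdj (λ k → k) v

  _≺_ : Fin n → Fin n → Set
  u ≺ v = (deg u ℕ.< deg v) ⊎ ((deg u ≡ deg v) × (id u ℤ.< id v))

  -- a sequence (t,u,v,w) representing the 3-path {(t,u),(u,v),(v,w)}
  record Quad : Set where
    constructor quad
    field
      t u v w : Fin n

  open Quad public

  reverse : Quad → Quad
  reverse (quad t u v w) = quad w v u t

  -- two sequences describe the same 3-path (same set of three edges)
  -- iff they are equal or reverses of each other
  SamePath : Quad → Quad → Set
  SamePath p q = (p ≡ q) ⊎ (p ≡ reverse q)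

  Is3Path : Quad → Set
  Is3Path (quad t u v w) =
    ¬ t ≡ u × ¬ t ≡ v × ¬ t ≡ w × ¬ u ≡ v × ¬ u ≡ w × ¬ v ≡ w ×
    Edge t u × Edge u v × Edge v w

  Centered : Quad → Set
  Centered (quad t u v w) = (v ≺ t) × (u ≺ w) × Edge t w

  record FourSet : Set where
    constructor fourSet
    field
      a b c d : Fin n
      ab : ¬ a ≡ b
      ac : ¬ a ≡ c
      ad : ¬ a ≡ d
      bc : ¬ b ≡ c
      bd : ¬ b ≡ d
      cd : ¬ c ≡ d

  _∈S_ : Fin n → FourSet → Set
  x ∈S S = (x ≡ a) ⊎ (x ≡ b) ⊎ (x ≡ c) ⊎ (x ≡ d)
    where open FourSet S

  -- all edges of the 3-path lie in G[S], i.e. all its vertices are in S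
  InS : Quad → FourSet → Set
  InS (quad t u v w) S = t ∈S S × u ∈S S × v ∈S S × w ∈S S

  CenteredIn : FourSet → Quad → Set
  CenteredIn S p = Is3Path p × InS p S × Centered p

  InducedIso : (Fin 4 → Fin 4 → Bool) → FourSet → Set
  InducedIso H S = Σ (Fin 4 → Fin n) λ σ →
    Injective _≡_ _≡_ σ × (∀ i → σ i ∈S S) × (∀ i j → adj (σ i) (σ j) ≡ H i j)

  ExactlyOne : FourSet → Set
  ExactlyOne S = Σ Quad λ p → CenteredIn S p × (∀ q → CenteredIn S q → SamePath q p)

  ExactlyThree : FourSet → Set
  ExactlyThree S = Σ Quad λ p₁ → Σ Quad λ p₂ → Σ Quad λ p₃ →
    CenteredIn S p₁ × CenteredIn S p₂ × CenteredIn S p₃ ×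
    ¬ SamePath p₁ p₂ × ¬ SamePath p₁ p₃ × ¬ SamePath p₂ p₃ ×
    (∀ q → CenteredIn S q → SamePath q p₁ ⊎ SamePath q p₂ ⊎ SamePath q p₃)

C4 : Fin 4 → Fin 4 → Bool
C4 zero (suc zero) = true
C4 (suc zero) zero = true
C4 (suc zero) (suc (suc zero)) = true
C4 (suc (suc zero)) (suc zero) = true
C4 (suc (suc zero)) (suc (suc (suc zero))) = true
C4 (suc (suc (suc zero))) (suc (suc zero)) = true
C4 (suc (suc (suc zero))) zero = true
C4 zero (suc (suc (suc zero))) = true
C4 _ _ = false

K4⁻ : Fin 4 → Fin 4 → Bool
K4⁻ zero zero = false
K4⁻ (suc zero) (suc zero) = false
K4⁻ (suc (suc zero)) (suc (suc zero)) = false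
K4⁻ (suc (suc (suc zero))) (suc (suc (suc zero))) = false
K4⁻ zero (suc (suc zero)) = false
K4⁻ (suc (suc zero)) zero = false
K4⁻ _ _ = true

K4 : Fin 4 → Fin 4 → Bool
K4 zero zero = false
K4 (suc zero) (suc zero) = false
K4 (suc (suc zero)) (suc (suc zero)) = false
K4 (suc (suc (suc zero))) (suc (suc (suc zero))) = false
K4 _ _ = true

module Submission where

-- A centered 3-path (t,u,v,w) closes up (by the edge tw) to the 4-cycle
-- t-u-v-w-t, whose diagonals are {t,v} and {u,w}.  Conversely, a 4-cycle
-- with diagonals {x,z} and {y,w} carries exactly one centered 3-path up to
-- reversal: orient each diagonal by ≺ as (hi,lo); the conditions v ≺ t and
-- u ≺ w force the path to be (hi₁,lo₂,lo₁,hi₂) or its reverse.  So the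
-- centered 3-paths of G[S] correspond to the 4-cycles of G[S].  Labelling
-- S as σ0,σ1,σ2,σ3, a 4-cycle on S is determined by its diagonals, one of
-- the three matchings {02|13}, {03|12}, {01|23}; in K4 all three cycles
-- exist, while in C4 and K4⁻ only the first does, because the other two
-- use the non-edge {σ0,σ2}.

open import Defs
open import Data.Nat using (ℕ)
open import Data.Product using (_×_)
open import Data.Sum using (_⊎_)

import Data.Integer.Properties as ℤₚ
import Data.Nat as ℕ
import Data.Nat.Properties as ℕₚ
open import Data.Bool using (false)
open import Data.Empty using (⊥-elim)
open import Data.Fin using (Fin; zero; suc; punchOut)
open import Data.Fin.Properties using (all?; any?; _≟_; punchOut-injective; injective⇒≤)
open import Data.List using (List; []; _∷_; length)
open import Data.List.Membership.Propositional using (_∈_)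
open import Data.List.Membership.Setoid.Properties using (index-injective)
open import Data.List.Relation.Unary.Any using (here; there; index)
open import Data.Product using (∃; _,_; proj₁; proj₂)
open import Data.Sum using (inj₁; inj₂)
open import Function using (_∘_)
open import Function.Definitions using (Injective)
open import Relation.Binary using (DecidableEquality; tri<; tri≈; tri>)
open import Relation.Binary.PropositionalEquality
  using (_≡_; _≢_; refl; sym; trans; cong; subst; setoid)
open import Relation.Nullary using (¬_; Dec; yes; no; ¬?)
open import Relation.Nullary.Decidable using (_×-dec_; _⊎-dec_; _→-dec_; map′; toWitness)

pattern 0F = zero
pattern 1F = suc zero
pattern 2F = suc (suc zero)
pattern 3F = suc (suc (suc zero))

module UnorderedPairs {A : Set} where

  data _∈⟨_,_⟩ : A → A → A → Set where
    left  : ∀ {x y} → x ∈⟨ x , y ⟩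
    right : ∀ {x y} → y ∈⟨ x , y ⟩

  SamePair : A → A → A → A → Set
  SamePair a b x y = (a ≡ x × b ≡ y) ⊎ (a ≡ y × b ≡ x)

  SamePair-sym : ∀ {a b x y} → SamePair a b x y → SamePair x y a b
  SamePair-sym (inj₁ (refl , refl)) = inj₁ (refl , refl)
  SamePair-sym (inj₂ (refl , refl)) = inj₂ (refl , refl)

  SamePair-trans : ∀ {a b x y c d} → SamePair a b x y → SamePair x y c d → SamePair a b c d
  SamePair-trans (inj₁ (refl , refl)) q                    = q
  SamePair-trans (inj₂ (refl , refl)) (inj₁ (refl , refl)) = inj₂ (refl , refl)
  SamePair-trans (inj₂ (refl , refl)) (inj₂ (refl , refl)) = inj₁ (refl , refl)

  SamePair-flip : ∀ {a b x y} → SamePair a b x y → SamePair b a x y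
  SamePair-flip (inj₁ (a≡x , b≡y)) = inj₂ (b≡y , a≡x)
  SamePair-flip (inj₂ (a≡y , b≡x)) = inj₁ (b≡x , a≡y)

  SamePair-⊆ : ∀ {a b x y} → SamePair a b x y → a ∈⟨ x , y ⟩ × b ∈⟨ x , y ⟩
  SamePair-⊆ (inj₁ (refl , refl)) = left , right
  SamePair-⊆ (inj₂ (refl , refl)) = right , left

  -- Read as cycles t-u-v-w-t and a-b-c-d-a, the two quadruples have the
  -- same diagonals: {{t,v},{u,w}} = {{a,c},{b,d}}.
  data SameDiagonals (t u v w a b c d : A) : Set where
    aligned : SamePair t v a c → SamePair u w b d → SameDiagonals t u v w a b c d
    crossed : SamePair t v b d → SamePair u w a c → SameDiagonals t u v w a b c d

  -- The diagonals of (t,u,v,w) form one of the three perfect matchings of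
  -- {a,b,c,d}: {ac|bd}, {ad|bc} or {ab|cd}.
  data Matchings (t u v w a b c d : A) : Set where
    ac∣bd : SameDiagonals t u v w a b c d → Matchings t u v w a b c d
    ad∣bc : SameDiagonals t u v w a b d c → Matchings t u v w a b c d
    ab∣cd : SameDiagonals t u v w a d b c → Matchings t u v w a b c d

  Distinct : A → A → A → A → Set
  Distinct x y z w = x ≢ y × x ≢ z × x ≢ w × y ≢ z × y ≢ w × z ≢ w

  ∈⟨⟩-closed : ∀ (P : A → Set) {x z a} → P x → P z → a ∈⟨ x , z ⟩ → P a
  ∈⟨⟩-closed P Px _ left  = Px
  ∈⟨⟩-closed P _ Pz right = Pz

  apart : ∀ {x y z w a b} → Distinct x y z w → a ∈⟨ x , z ⟩ → b ∈⟨ y , w ⟩ → a ≢ b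
  apart (x≢y , _ , _   , _   , _ , _  ) left  left  = x≢y
  apart (_   , _ , x≢w , _   , _ , _  ) left  right = x≢w
  apart (_   , _ , _   , y≢z , _ , _  ) right left  = y≢z ∘ sym
  apart (_   , _ , _   , _   , _ , z≢w) right right = z≢w

  module Decide (_≟_ : DecidableEquality A) where

    samePair? : ∀ a b x y → Dec (SamePair a b x y)
    samePair? a b x y = ((a ≟ x) ×-dec (b ≟ y)) ⊎-dec ((a ≟ y) ×-dec (b ≟ x))

    sameDiagonals? : ∀ t u v w a b c d → Dec (SameDiagonals t u v w a b c d)
    sameDiagonals? t u v w a b c d =
      map′ (λ { (inj₁ (tv , uw)) → aligned tv uw ; (inj₂ (tv , uw)) → crossed tv uw })
           (λ { (aligned tv uw) → inj₁ (tv , uw) ; (crossed tv uw) → inj₂ (tv , uw) })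
           ((samePair? t v a c ×-dec samePair? u w b d) ⊎-dec (samePair? t v b d ×-dec samePair? u w a c))

    matchings? : ∀ t u v w a b c d → Dec (Matchings t u v w a b c d)
    matchings? t u v w a b c d =
      map′ (λ { (inj₁ m) → ac∣bd m ; (inj₂ (inj₁ m)) → ad∣bc m ; (inj₂ (inj₂ m)) → ab∣cd m })
           (λ { (ac∣bd m) → inj₁ m ; (ad∣bc m) → inj₂ (inj₁ m) ; (ab∣cd m) → inj₂ (inj₂ m) })
           (sameDiagonals? t u v w a b c d ⊎-dec sameDiagonals? t u v w a b d c ⊎-dec sameDiagonals? t u v w a d b c)

    distinct? : ∀ x y z w → Dec (Distinct x y z w)
    distinct? x y z w =
      ¬? (x ≟ y) ×-dec ¬? (x ≟ z) ×-dec ¬? (x ≟ w) ×-dec ¬? (y ≟ z) ×-dec ¬? (y ≟ w) ×-dec ¬? (z ≟ w)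

open UnorderedPairs

module _ {A B : Set} (f : A → B) where

  SamePair-map : ∀ {a b x y} → SamePair a b x y → SamePair (f a) (f b) (f x) (f y)
  SamePair-map (inj₁ (a≡x , b≡y)) = inj₁ (cong f a≡x , cong f b≡y)
  SamePair-map (inj₂ (a≡y , b≡x)) = inj₂ (cong f a≡y , cong f b≡x)

  SamePair-unmap : Injective _≡_ _≡_ f →
                   ∀ {a b x y} → SamePair (f a) (f b) (f x) (f y) → SamePair a b x y
  SamePair-unmap f-inj (inj₁ (a≡x , b≡y)) = inj₁ (f-inj a≡x , f-inj b≡y)
  SamePair-unmap f-inj (inj₂ (a≡y , b≡x)) = inj₂ (f-inj a≡y , f-inj b≡x)

  SameDiagonals-map : ∀ {t u v w a b c d} → SameDiagonals t u v w a b c d →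
                      SameDiagonals (f t) (f u) (f v) (f w) (f a) (f b) (f c) (f d)
  SameDiagonals-map (aligned tv uw) = aligned (SamePair-map tv) (SamePair-map uw)
  SameDiagonals-map (crossed tv uw) = crossed (SamePair-map tv) (SamePair-map uw)

  Matchings-map : ∀ {t u v w a b c d} → Matchings t u v w a b c d →
                  Matchings (f t) (f u) (f v) (f w) (f a) (f b) (f c) (f d)
  Matchings-map (ac∣bd m) = ac∣bd (SameDiagonals-map m)
  Matchings-map (ad∣bc m) = ad∣bc (SameDiagonals-map m)
  Matchings-map (ab∣cd m) = ab∣cd (SameDiagonals-map m)

  Distinct-map : Injective _≡_ _≡_ f → ∀ {x y z w} → Distinct x y z w → Distinct (f x) (f y) (f z) (f w)
  Distinct-map f-inj (x≢y , x≢z , x≢w , y≢z , y≢w , z≢w) =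
    x≢y ∘ f-inj , x≢z ∘ f-inj , x≢w ∘ f-inj , y≢z ∘ f-inj , y≢w ∘ f-inj , z≢w ∘ f-inj

module Orientation {A : Set} (_<_ : A → A → Set) (<-asym : ∀ {a b} → a < b → ¬ b < a) where

  record Oriented (x z : A) : Set where
    field
      hi lo : A
      lo<hi : lo < hi
      pair  : SamePair hi lo x z

  open Oriented public

  pinned : ∀ {a b x z} → b < a → SamePair a b x z → (o : Oriented x z) → a ≡ hi o × b ≡ lo o
  pinned b<a ab≐xz o with SamePair-trans ab≐xz (SamePair-sym (pair o))
  ... | inj₁ eqs          = eqs
  ... | inj₂ (refl , refl) = ⊥-elim (<-asym b<a (lo<hi o))

  same-ends : ∀ {x z x′ z′} (o : Oriented x z) (o′ : Oriented x′ z′) →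
              hi o ≡ hi o′ → lo o ≡ lo o′ → SamePair x z x′ z′
  same-ends o o′ hi≡ lo≡ =
    SamePair-trans (SamePair-sym (pair o)) (SamePair-trans (inj₁ (hi≡ , lo≡)) (pair o′))

-- Every quadruple of distinct elements of Fin 4 has the diagonals of one of
-- the three matchings of (0,1,2,3); a finite check over the 256 quadruples.
classify : ∀ i j k l → Distinct i j k l → Matchings i j k l 0F 1F 2F 3F
classify = toWitness {a? = all? λ i → all? λ j → all? λ k → all? λ l →
                             distinct? i j k l →-dec matchings? i j k l 0F 1F 2F 3F} _
  where open Decide {A = Fin 4} _≟_

injective⇒onto : ∀ {m} (f : Fin m → Fin m) → Injective _≡_ _≡_ f → ∀ k → ∃ λ i → f i ≡ k
injective⇒onto {ℕ.suc m} f f-inj k with any? (λ i → f i ≟ k)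
... | yes hit = hit
... | no miss = ⊥-elim (ℕₚ.n≮n m (injective⇒≤ g-inj))
  where
  k≢f : ∀ i → k ≢ f i
  k≢f i k≡fi = miss (i , sym k≡fi)

  g : Fin (ℕ.suc m) → Fin m
  g i = punchOut (k≢f i)

  g-inj : Injective _≡_ _≡_ g
  g-inj {i} {j} e = f-inj (punchOut-injective (k≢f i) (k≢f j) e)

injective-into-list⇒onto : ∀ {A : Set} (xs : List A) (f : Fin (length xs) → A) →
  Injective _≡_ _≡_ f → (∀ i → f i ∈ xs) → ∀ {x} → x ∈ xs → ∃ λ i → f i ≡ x
injective-into-list⇒onto {A} xs f f-inj f∈ x∈ =
  let (i , same-position) = injective⇒onto position position-inj (index x∈)
  in i , index-injective (setoid A) (f∈ i) x∈ same-position
  where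
  position : Fin (length xs) → Fin (length xs)
  position i = index (f∈ i)

  position-inj : Injective _≡_ _≡_ position
  position-inj e = f-inj (index-injective (setoid A) (f∈ _) (f∈ _) e)

module _ {n : ℕ} (G : Graph n) where
  open Graph G using (adj; id; id-inj)

  private
    _≺ᴳ_ : Fin n → Fin n → Set
    _≺ᴳ_ = _≺_ G

  ≺-asym : ∀ {x y} → x ≺ᴳ y → ¬ y ≺ᴳ x
  ≺-asym (inj₁ x<y)       (inj₁ y<x)       = ℕₚ.<-asym x<y y<x
  ≺-asym (inj₁ x<y)       (inj₂ (y≡x , _)) = ℕₚ.<-irrefl (sym y≡x) x<y
  ≺-asym (inj₂ (x≡y , _)) (inj₁ y<x)       = ℕₚ.<-irrefl (sym x≡y) y<x
  ≺-asym (inj₂ (_ , x<y)) (inj₂ (_ , y<x)) = ℤₚ.<-asym x<y y<x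

  ≺-irrefl : ∀ {x} → ¬ x ≺ᴳ x
  ≺-irrefl x≺x = ≺-asym x≺x x≺x

  ≺-connex : ∀ {x y} → x ≢ y → x ≺ᴳ y ⊎ y ≺ᴳ x
  ≺-connex {x} {y} x≢y with ℕₚ.<-cmp (deg G x) (deg G y)
  ... | tri< d< _ _ = inj₁ (inj₁ d<)
  ... | tri> _ _ d> = inj₂ (inj₁ d>)
  ... | tri≈ _ d≡ _ with ℤₚ.<-cmp (id x) (id y)
  ...   | tri< i< _ _ = inj₁ (inj₂ (d≡ , i<))
  ...   | tri> _ _ i> = inj₂ (inj₂ (sym d≡ , i>))
  ...   | tri≈ _ i≡ _ = ⊥-elim (x≢y (id-inj i≡))

  open Orientation _≺ᴳ_ ≺-asym

  orient : ∀ {x z} → x ≢ z → Oriented x z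
  orient {x} {z} x≢z with ≺-connex x≢z
  ... | inj₁ x≺z = record { hi = z ; lo = x ; lo<hi = x≺z ; pair = inj₂ (refl , refl) }
  ... | inj₂ z≺x = record { hi = x ; lo = z ; lo<hi = z≺x ; pair = inj₁ (refl , refl) }

  hi≢lo : ∀ {x z} (o : Oriented x z) → hi o ≢ lo o
  hi≢lo o hi≡lo = ≺-irrefl (subst (lo o ≺ᴳ_) hi≡lo (lo<hi o))

  edge-sym : ∀ {x y} → Edge G x y → Edge G y x
  edge-sym {x} {y} e = trans (Graph.sym G y x) e

  non-edge : ∀ {x y} → adj x y ≡ false → ¬ Edge G x y
  non-edge x≁y e with trans (sym e) x≁y
  ... | ()

  Cycle : Fin n → Fin n → Fin n → Fin n → Set
  Cycle t u v w = Edge G t u × Edge G u v × Edge G v w × Edge G w t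

  cycle-of-centered : ∀ {t u v w} → Is3Path G (quad t u v w) → Centered G (quad t u v w) → Cycle t u v w
  cycle-of-centered (_ , _ , _ , _ , _ , _ , tu , uv , vw) (_ , _ , tw) = tu , uv , vw , edge-sym tw

  cross : ∀ {t u v w a b} → Cycle t u v w → a ∈⟨ t , v ⟩ → b ∈⟨ u , w ⟩ → Edge G a b
  cross (tu , _  , _  , _ ) left  left  = tu
  cross (_  , _  , _  , wt) left  right = edge-sym wt
  cross (_  , uv , _  , _ ) right left  = edge-sym uv
  cross (_  , _  , vw , _ ) right right = vw

  closing-edge : ∀ {t u v w a b c d} → Cycle t u v w → SameDiagonals t u v w a b c d → Edge G d a
  closing-edge cyc (aligned tv≐ac uw≐bd) =
    edge-sym (cross cyc (proj₁ (SamePair-⊆ (SamePair-sym tv≐ac))) (proj₂ (SamePair-⊆ (SamePair-sym uw≐bd))))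
  closing-edge cyc (crossed tv≐bd uw≐ac) =
    cross cyc (proj₂ (SamePair-⊆ (SamePair-sym tv≐bd))) (proj₁ (SamePair-⊆ (SamePair-sym uw≐ac)))

  canon : ∀ {x y z w} → Oriented x z → Oriented y w → Quad G
  canon o₁ o₂ = quad (hi o₁) (lo o₂) (lo o₁) (hi o₂)

  canon-centered : ∀ S {x y z w} → Distinct x y z w → Cycle x y z w →
    _∈S_ G x S → _∈S_ G y S → _∈S_ G z S → _∈S_ G w S →
    (o₁ : Oriented x z) (o₂ : Oriented y w) → CenteredIn G S (canon o₁ o₂)
  canon-centered S {x} {y} {z} {w} dist cyc x∈S y∈S z∈S w∈S o₁ o₂ =
      ( apart dist h₁ l₂ , hi≢lo o₁ , apart dist h₁ h₂ , apart dist l₁ l₂ ∘ sym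
      , hi≢lo o₂ ∘ sym , apart dist l₁ h₂
      , cross cyc h₁ l₂ , edge-sym (cross cyc l₁ l₂) , cross cyc l₁ h₂ )
    , (in-S x∈S z∈S h₁ , in-S y∈S w∈S l₂ , in-S x∈S z∈S l₁ , in-S y∈S w∈S h₂)
    , (lo<hi o₁ , lo<hi o₂ , cross cyc h₁ h₂)
    where
    h₁ : hi o₁ ∈⟨ x , z ⟩
    h₁ = proj₁ (SamePair-⊆ (pair o₁))
    l₁ : lo o₁ ∈⟨ x , z ⟩
    l₁ = proj₂ (SamePair-⊆ (pair o₁))
    h₂ : hi o₂ ∈⟨ y , w ⟩
    h₂ = proj₁ (SamePair-⊆ (pair o₂))
    l₂ : lo o₂ ∈⟨ y , w ⟩
    l₂ = proj₂ (SamePair-⊆ (pair o₂))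

    in-S : ∀ {p q a} → _∈S_ G p S → _∈S_ G q S → a ∈⟨ p , q ⟩ → _∈S_ G a S
    in-S = ∈⟨⟩-closed (λ a → _∈S_ G a S)

  quad-≡ : ∀ {t u v w t′ u′ v′ w′} → t ≡ t′ → u ≡ u′ → v ≡ v′ → w ≡ w′ → quad {G = G} t u v w ≡ quad t′ u′ v′ w′
  quad-≡ refl refl refl refl = refl

  quad-injective : ∀ {t u v w t′ u′ v′ w′} → quad {G = G} t u v w ≡ quad t′ u′ v′ w′ →
                   t ≡ t′ × u ≡ u′ × v ≡ v′ × w ≡ w′
  quad-injective refl = refl , refl , refl , refl

  centered-unique : ∀ {t u v w x y z w′} → v ≺ᴳ t → u ≺ᴳ w → SameDiagonals t u v w x y z w′ →
    (o₁ : Oriented x z) (o₂ : Oriented y w′) → SamePath G (quad t u v w) (canon o₁ o₂)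
  centered-unique v≺t u≺w (aligned tv≐xz uw≐yw) o₁ o₂ =
    let (t≡ , v≡) = pinned v≺t tv≐xz o₁
        (w≡ , u≡) = pinned u≺w (SamePair-flip uw≐yw) o₂
    in inj₁ (quad-≡ t≡ u≡ v≡ w≡)
  centered-unique v≺t u≺w (crossed tv≐yw uw≐xz) o₁ o₂ =
    let (t≡ , v≡) = pinned v≺t tv≐yw o₂
        (w≡ , u≡) = pinned u≺w (SamePair-flip uw≐xz) o₁
    in inj₂ (quad-≡ t≡ u≡ v≡ w≡)

  canon-same-diagonal : ∀ {x y z w x′ y′ z′ w′}
    (o₁ : Oriented x z) (o₂ : Oriented y w) (o₃ : Oriented x′ z′) (o₄ : Oriented y′ w′) →
    SamePath G (canon o₁ o₂) (canon o₃ o₄) → SamePair x z x′ z′ ⊎ SamePair x z y′ w′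
  canon-same-diagonal o₁ o₂ o₃ o₄ (inj₁ e) =
    let (hi≡ , _ , lo≡ , _) = quad-injective e in inj₁ (same-ends o₁ o₃ hi≡ lo≡)
  canon-same-diagonal o₁ o₂ o₃ o₄ (inj₂ e) =
    let (hi≡ , _ , lo≡ , _) = quad-injective e in inj₂ (same-ends o₁ o₄ hi≡ lo≡)

  module Labelled (S : FourSet G) (σ : Fin 4 → Fin n) (σ-inj : Injective _≡_ _≡_ σ)
                  (σ-in : ∀ i → _∈S_ G (σ i) S) where
    open FourSet S

    ∈S⇒∈ : ∀ {x} → _∈S_ G x S → x ∈ (a ∷ b ∷ c ∷ d ∷ [])
    ∈S⇒∈ (inj₁ x≡a)               = here x≡a
    ∈S⇒∈ (inj₂ (inj₁ x≡b))        = there (here x≡b)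
    ∈S⇒∈ (inj₂ (inj₂ (inj₁ x≡c))) = there (there (here x≡c))
    ∈S⇒∈ (inj₂ (inj₂ (inj₂ x≡d))) = there (there (there (here x≡d)))

    σ-onto : ∀ {x} → _∈S_ G x S → ∃ λ i → σ i ≡ x
    σ-onto x∈S = injective-into-list⇒onto _ σ σ-inj (∈S⇒∈ ∘ σ-in) (∈S⇒∈ x∈S)

    label-orient : ∀ i j → i ≢ j → Oriented (σ i) (σ j)
    label-orient i j i≢j = orient (i≢j ∘ σ-inj)

    centered-matching : ∀ {t u v w} → CenteredIn G S (quad t u v w) →
                        Matchings t u v w (σ 0F) (σ 1F) (σ 2F) (σ 3F)
    centered-matching ((t≢u , t≢v , t≢w , u≢v , u≢w , v≢w , _) , (t∈S , u∈S , v∈S , w∈S) , _)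
      with σ-onto t∈S | σ-onto u∈S | σ-onto v∈S | σ-onto w∈S
    ... | i , refl | j , refl | k , refl | l , refl =
      Matchings-map σ (classify i j k l
        (t≢u ∘ cong σ , t≢v ∘ cong σ , t≢w ∘ cong σ , u≢v ∘ cong σ , u≢w ∘ cong σ , v≢w ∘ cong σ))

    labelled-canon-centered : ∀ {i j k l} → Distinct i j k l → Cycle (σ i) (σ j) (σ k) (σ l) →
      (o₁ : Oriented (σ i) (σ k)) (o₂ : Oriented (σ j) (σ l)) → CenteredIn G S (canon o₁ o₂)
    labelled-canon-centered {i} {j} {k} {l} dist cyc =
      canon-centered S (Distinct-map σ σ-inj {i} {j} {k} {l} dist) cyc (σ-in i) (σ-in j) (σ-in k) (σ-in l)

    different-canon : ∀ {i j k l i′ j′ k′ l′}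
      (o₁ : Oriented (σ i) (σ k)) (o₂ : Oriented (σ j) (σ l))
      (o₃ : Oriented (σ i′) (σ k′)) (o₄ : Oriented (σ j′) (σ l′)) →
      ¬ SamePair i k i′ k′ → ¬ SamePair i k j′ l′ → ¬ SamePath G (canon o₁ o₂) (canon o₃ o₄)
    different-canon o₁ o₂ o₃ o₄ ne₁ ne₂ same with canon-same-diagonal o₁ o₂ o₃ o₄ same
    ... | inj₁ ik≐ = ne₁ (SamePair-unmap σ σ-inj ik≐)
    ... | inj₂ ik≐ = ne₂ (SamePair-unmap σ σ-inj ik≐)

    exactly-one : Cycle (σ 0F) (σ 1F) (σ 2F) (σ 3F) → ¬ Edge G (σ 2F) (σ 0F) → ExactlyOne G S
    exactly-one cyc no-chord =
        canon o₀₂ o₁₃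
      , labelled-canon-centered ((λ ()) , (λ ()) , (λ ()) , (λ ()) , (λ ()) , (λ ())) cyc o₀₂ o₁₃
      , unique
      where
      o₀₂ : Oriented (σ 0F) (σ 2F)
      o₀₂ = label-orient 0F 2F (λ ())
      o₁₃ : Oriented (σ 1F) (σ 3F)
      o₁₃ = label-orient 1F 3F (λ ())

      unique : ∀ q → CenteredIn G S q → SamePath G q (canon o₀₂ o₁₃)
      unique (quad t u v w) c@(path , _ , cen@(v≺t , u≺w , _)) with centered-matching c
      ... | ac∣bd diag = centered-unique v≺t u≺w diag o₀₂ o₁₃
      ... | ad∣bc diag = ⊥-elim (no-chord (closing-edge (cycle-of-centered path cen) diag))
      ... | ab∣cd diag = ⊥-elim (no-chord (closing-edge (cycle-of-centered path cen) diag))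

    exactly-three : Cycle (σ 0F) (σ 1F) (σ 2F) (σ 3F) → Cycle (σ 0F) (σ 1F) (σ 3F) (σ 2F) →
                    Cycle (σ 0F) (σ 3F) (σ 1F) (σ 2F) → ExactlyThree G S
    exactly-three cyc₁ cyc₂ cyc₃ =
        p₁ , p₂ , p₃
      , labelled-canon-centered ((λ ()) , (λ ()) , (λ ()) , (λ ()) , (λ ()) , (λ ())) cyc₁ o₀₂ o₁₃
      , labelled-canon-centered ((λ ()) , (λ ()) , (λ ()) , (λ ()) , (λ ()) , (λ ())) cyc₂ o₀₃ o₁₂
      , labelled-canon-centered ((λ ()) , (λ ()) , (λ ()) , (λ ()) , (λ ()) , (λ ())) cyc₃ o₀₁ o₃₂
      , different-canon o₀₂ o₁₃ o₀₃ o₁₂ (λ { (inj₁ (_ , ())) ; (inj₂ (() , _)) })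
                                        (λ { (inj₁ (() , _)) ; (inj₂ (() , _)) })
      , different-canon o₀₂ o₁₃ o₀₁ o₃₂ (λ { (inj₁ (_ , ())) ; (inj₂ (() , _)) })
                                        (λ { (inj₁ (() , _)) ; (inj₂ (() , _)) })
      , different-canon o₀₃ o₁₂ o₀₁ o₃₂ (λ { (inj₁ (_ , ())) ; (inj₂ (() , _)) })
                                        (λ { (inj₁ (() , _)) ; (inj₂ (() , _)) })
      , unique
      where
      o₀₂ : Oriented (σ 0F) (σ 2F)
      o₀₂ = label-orient 0F 2F (λ ())
      o₁₃ : Oriented (σ 1F) (σ 3F)
      o₁₃ = label-orient 1F 3F (λ ())
      o₀₃ : Oriented (σ 0F) (σ 3F)
      o₀₃ = label-orient 0F 3F (λ ())
      o₁₂ : Oriented (σ 1F) (σ 2F)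
      o₁₂ = label-orient 1F 2F (λ ())
      o₀₁ : Oriented (σ 0F) (σ 1F)
      o₀₁ = label-orient 0F 1F (λ ())
      o₃₂ : Oriented (σ 3F) (σ 2F)
      o₃₂ = label-orient 3F 2F (λ ())

      p₁ p₂ p₃ : Quad G
      p₁ = canon o₀₂ o₁₃
      p₂ = canon o₀₃ o₁₂
      p₃ = canon o₀₁ o₃₂

      unique : ∀ q → CenteredIn G S q → SamePath G q p₁ ⊎ SamePath G q p₂ ⊎ SamePath G q p₃
      unique (quad t u v w) c@(_ , _ , v≺t , u≺w , _) with centered-matching c
      ... | ac∣bd diag = inj₁ (centered-unique v≺t u≺w diag o₀₂ o₁₃)
      ... | ad∣bc diag = inj₂ (inj₁ (centered-unique v≺t u≺w diag o₀₃ o₁₂))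
      ... | ab∣cd diag = inj₂ (inj₂ (centered-unique v≺t u≺w diag o₀₁ o₃₂))

lemma1 : {n : ℕ} (G : Graph n) (S : FourSet G) →
         ((InducedIso G C4 S ⊎ InducedIso G K4⁻ S) → ExactlyOne G S) ×
         (InducedIso G K4 S → ExactlyThree G S)
lemma1 G S = one , three
  where
  open Labelled G S

  -- C4 and K4⁻ both contain the cycle 0-1-2-3 and lack the chord {0,2}
  one : InducedIso G C4 S ⊎ InducedIso G K4⁻ S → ExactlyOne G S
  one (inj₁ (σ , σ-inj , σ-in , iso)) =
    exactly-one σ σ-inj σ-in (iso 0F 1F , iso 1F 2F , iso 2F 3F , iso 3F 0F) (non-edge G (iso 2F 0F))
  one (inj₂ (σ , σ-inj , σ-in , iso)) =
    exactly-one σ σ-inj σ-in (iso 0F 1F , iso 1F 2F , iso 2F 3F , iso 3F 0F) (non-edge G (iso 2F 0F))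

  -- K4 contains all three 4-cycles on its vertices
  three : InducedIso G K4 S → ExactlyThree G S
  three (σ , σ-inj , σ-in , iso) =
    exactly-three σ σ-inj σ-in
      (iso 0F 1F , iso 1F 2F , iso 2F 3F , iso 3F 0F)
      (iso 0F 1F , iso 1F 3F , iso 3F 2F , iso 2F 0F)
      (iso 0F 3F , iso 3F 1F , iso 1F 2F , iso 2F 0F)
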